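{- If every separable metric space is sober (with respect to its metric topology), then the Limited Principle of Omniscience holds: every $\alpha\in 2^{\mathbb{N}}$ is either equal to the zero sequence or apart from it (i.e. $\exists n\,\alpha(n)\ne 0$).
   Context: We work constructively in higher-order intuitionistic logic with Dependent Choice. $\Sigma = \{p \in \Omega \mid \exists f \in 2^{\mathbb{N}}\,(p \Leftrightarrow \exists n\, f(n)=1)\}$. For a metric space $(M,d)$ the metric topology $\mathcal{T}$ consists of countable unions of open balls $B(y,r)=\{z \mid d(y,z)<r\}$. Separable means there is a dense sequence. $M$ is sober if the map $x\mapsto\hat{x}$, $\hat{x}(U)=(x\in U)$, is a bijection from $M$ onto the set of maps $\mathcal{T}\to\Sigma$ preserving finite intersections (including $M\mapsto\top$) and countable unions. -}

module Defs where

open import Level using (0ℓ)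
open import Data.Nat as ℕ using (ℕ; suc; _*_)
open import Data.Integer as ℤ using (+_)
open import Data.Rational as ℚ using (ℚ; 0ℚ; ∣_∣)
open import Data.Bool using (Bool; true; false)
open import Data.Maybe using (Maybe; just)
open import Data.Product using (Σ; ∃; ∃-syntax; _×_; _,_)
open import Data.Sum using (_⊎_)
open import Data.Unit using (⊤)
open import Data.Empty using (⊥)
open import Relation.Nullary using (¬_)
open import Relation.Binary.PropositionalEquality using (_≡_)
open import Function.Bundles using (_⇔_)

Seq : Set
Seq = ℕ → ℚ

inv : ℕ → ℚ
inv n = (+ 1) ℚ./ suc n

inv2 : ℕ → ℚ
inv2 n = (+ 2) ℚ./ suc n

Regular : Seq → Set
Regular x = ∀ m n → ∣ x m ℚ.- x n ∣ ℚ.≤ inv m ℚ.+ inv n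

record ℝ : Set where
  constructor mkℝ
  field
    seq : Seq
    reg : Regular seq
open ℝ public

-- order, equality and addition, stated on the underlying sequences
-- (Bishop: x < y iff y_n - x_n > 2/n for some n)
_<ˢ_ : Seq → Seq → Set
x <ˢ y = ∃[ n ] (x n ℚ.+ inv2 n ℚ.< y n)

_≤ˢ_ : Seq → Seq → Set
x ≤ˢ y = ¬ (y <ˢ x)

_≃ˢ_ : Seq → Seq → Set
x ≃ˢ y = (x ≤ˢ y) × (y ≤ˢ x)

_+ˢ_ : Seq → Seq → Seq
(x +ˢ y) n = x (suc (2 * n)) ℚ.+ y (suc (2 * n))

0ˢ : Seq
0ˢ _ = 0ℚ

infix 4 _<ʳ_ _≤ʳ_ _≃ʳ_
_<ʳ_ : ℝ → ℝ → Set
x <ʳ y = seq x <ˢ seq y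

_≤ʳ_ : ℝ → ℝ → Set
x ≤ʳ y = seq x ≤ˢ seq y

_≃ʳ_ : ℝ → ℝ → Set
x ≃ʳ y = seq x ≃ˢ seq y

record MetricSpace : Set₁ where
  field
    Carrier : Set
    d       : Carrier → Carrier → ℝ
    d-refl  : ∀ x → seq (d x x) ≃ˢ 0ˢ
    d-sym   : ∀ x y → d x y ≃ʳ d y x
    d-tri   : ∀ x y z → seq (d x z) ≤ˢ (seq (d x y) +ˢ seq (d y z))

  _≈_ : Carrier → Carrier → Set
  x ≈ y = seq (d x y) ≃ˢ 0ˢ

  Ball : Carrier → ℝ → Carrier → Set
  Ball y r z = d y z <ʳ r

  -- U is a countable union of open balls: enumerated by a sequence
  -- with possible gaps (so that the empty family is allowed)
  IsOpen : (Carrier → Set) → Set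
  IsOpen U = Σ (ℕ → Maybe (Carrier × ℝ)) λ s →
    ∀ z → U z ⇔ (∃[ n ] ∃[ y ] ∃[ r ] ((s n ≡ just (y , r)) × Ball y r z))

  record Open : Set₁ where
    constructor mkOpen
    field
      mem    : Carrier → Set
      isOpen : IsOpen mem
  open Open public

  _≐_ : Open → Open → Set
  U ≐ V = ∀ z → mem U z ⇔ mem V z

  Dense : (ℕ → Carrier) → Set
  Dense s = ∀ x (ε : ℝ) → 0ˢ <ˢ seq ε → ∃[ n ] (d x (s n) <ʳ ε)

  -- the Sierpinski-type Σ: p ⇔ ∃ n, f n = 1
  InΣ : Set → Set
  InΣ p = Σ (ℕ → Bool) λ f → p ⇔ (∃[ n ] (f n ≡ true))

  record Point : Set₁ where
    field
      φ      : Open → Set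
      φ-Σ    : ∀ U → InΣ (φ U)
      -- φ is a function on the set T of (extensionally equal) subsets
      φ-ext  : ∀ U V → U ≐ V → φ U ⇔ φ V
      φ-top  : ∀ W → (∀ z → mem W z) → φ W ⇔ ⊤
      φ-meet : ∀ U V W → (∀ z → mem W z ⇔ (mem U z × mem V z)) →
               φ W ⇔ (φ U × φ V)
      φ-join : ∀ (F : ℕ → Maybe Open) W →
               (∀ z → mem W z ⇔ (∃[ n ] ∃[ U ] ((F n ≡ just U) × mem U z))) →
               φ W ⇔ (∃[ n ] ∃[ U ] ((F n ≡ just U) × φ U))
  open Point public

Separable : MetricSpace → Set
Separable X = Σ (ℕ → Carrier) Dense
  where open MetricSpace X

-- x ↦ x̂ is a bijection from M onto the points
Sober : MetricSpace → Set₁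
Sober X =
  (∀ x y → (∀ (U : Open) → mem U x ⇔ mem U y) → x ≈ y)
  × (∀ (P : Point) → ∃[ x ] (∀ (U : Open) → φ P U ⇔ mem U x))
  where open MetricSpace X

-- Limited Principle of Omniscience (2 = Bool, 0 = false, 1 = true)
LPO : Set
LPO = ∀ (α : ℕ → Bool) → (∀ n → α n ≡ false) ⊎ (∃[ n ] (α n ≡ true))

module Submission where

open import Defs

open import Data.Nat as ℕ using (ℕ; zero; suc; z≤n; s≤s; _≤′_; ≤′-refl; ≤′-step)
import Data.Nat.Properties as ℕ
open import Data.Nat.Tactic.RingSolver using (solve-∀)
open import Data.Integer as ℤ using (+_)
import Data.Integer.Properties as ℤ
open import Data.Rational as ℚ using (ℚ; 0ℚ; ∣_∣; _+_; _-_; -_; _≤_; _<_; toℚᵘ)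
open import Data.Rational.Properties
open import Data.Rational.Solver using (module +-*-Solver)
open import Data.Rational.Unnormalised as ℚᵘ using (mkℚᵘ; *≤*; *<*; *≡*)
import Data.Rational.Unnormalised.Properties as ℚᵘ
open import Data.Bool using (Bool; true; false; if_then_else_)
open import Data.Bool.Properties using (¬-not)
open import Data.Maybe using (Maybe; just; nothing; _<∣>_)
open import Data.Product using (∃; ∃-syntax; _×_; _,_; proj₁; proj₂)
open import Data.Sum using (_⊎_; inj₁; inj₂)
open import Data.Unit using (⊤; tt)
open import Relation.Nullary using (¬_; Dec; yes; no; does)
open import Relation.Nullary.Decidable using (dec-true)
open import Relation.Binary.PropositionalEquality
open import Function using (case_of_; _∘_)
open import Function.Bundles using (_⇔_; mk⇔; Equivalence)
open import Function.Construct.Composition using (_⇔-∘_)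

open +-*-Solver

-- Let c n be 1/(k+1) once the first k with α k = 1 has appeared by stage n,
-- and 0 before. On ℕ with distance |c m - c n| (separable by the identity
-- sequence), the open sets containing a tail of 0, 1, 2, … form a point in
-- the sense of sobriety: membership is Σ because a tail lies in U as soon as
-- a ball of U contains c n with margin 3/(n+1), and it commutes with countable
-- unions because c is constant both before and after the first hit. The
-- element x that sobriety provides decides α: if c x ≠ 0 it exhibits a hit,
-- and if c x = 0 a hit k would keep the tail at distance 1/(k+1) from x, out
-- of the ball of that radius about x.

frac : ℕ → ℕ → ℚ
frac a n = + a ℚ./ suc n

private
  toℚᵘ-frac : ∀ a n → toℚᵘ (frac a n) ℚᵘ.≃ mkℚᵘ (+ a) n
  toℚᵘ-frac a n = toℚᵘ-fromℚᵘ (mkℚᵘ (+ a) n)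

frac-≤ : ∀ {a b m n} → a ℕ.* suc n ℕ.≤ b ℕ.* suc m → frac a m ≤ frac b n
frac-≤ {a} {b} {m} {n} h = toℚᵘ-cancel-≤
  (ℚᵘ.≤-respʳ-≃ (ℚᵘ.≃-sym (toℚᵘ-frac b n)) (ℚᵘ.≤-respˡ-≃ (ℚᵘ.≃-sym (toℚᵘ-frac a m))
    (*≤* (subst₂ ℤ._≤_ (ℤ.pos-* a (suc n)) (ℤ.pos-* b (suc m)) (ℤ.+≤+ h)))))

frac-< : ∀ {a b m n} → a ℕ.* suc n ℕ.< b ℕ.* suc m → frac a m < frac b n
frac-< {a} {b} {m} {n} h = toℚᵘ-cancel-<
  (ℚᵘ.<-respʳ-≃ (ℚᵘ.≃-sym (toℚᵘ-frac b n)) (ℚᵘ.<-respˡ-≃ (ℚᵘ.≃-sym (toℚᵘ-frac a m))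
    (*<* (subst₂ ℤ._<_ (ℤ.pos-* a (suc n)) (ℤ.pos-* b (suc m)) (ℤ.+<+ h)))))

frac-+ : ∀ a b n → frac a n + frac b n ≡ frac (a ℕ.+ b) n
frac-+ a b n = toℚᵘ-injective (ℚᵘ.≃-trans (toℚᵘ-homo-+ (frac a n) (frac b n))
  (ℚᵘ.≃-trans (ℚᵘ.+-cong (toℚᵘ-frac a n) (toℚᵘ-frac b n))
  (ℚᵘ.≃-trans (*≡* cross) (ℚᵘ.≃-sym (toℚᵘ-frac (a ℕ.+ b) n)))))
  where
  s = suc n
  cross : (+ a ℤ.* + s ℤ.+ + b ℤ.* + s) ℤ.* + s ≡ + (a ℕ.+ b) ℤ.* + (s ℕ.* s)
  cross = begin
    (+ a ℤ.* + s ℤ.+ + b ℤ.* + s) ℤ.* + s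
      ≡⟨ cong (ℤ._* + s) (cong₂ ℤ._+_ (sym (ℤ.pos-* a s)) (sym (ℤ.pos-* b s))) ⟩
    (+ (a ℕ.* s) ℤ.+ + (b ℕ.* s)) ℤ.* + s
      ≡⟨ cong (ℤ._* + s) (sym (ℤ.pos-+ (a ℕ.* s) (b ℕ.* s))) ⟩
    + (a ℕ.* s ℕ.+ b ℕ.* s) ℤ.* + s
      ≡⟨ sym (ℤ.pos-* (a ℕ.* s ℕ.+ b ℕ.* s) s) ⟩
    + ((a ℕ.* s ℕ.+ b ℕ.* s) ℕ.* s)
      ≡⟨ cong +_ (distrib a b s) ⟩
    + ((a ℕ.+ b) ℕ.* (s ℕ.* s))
      ≡⟨ ℤ.pos-* (a ℕ.+ b) (s ℕ.* s) ⟩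
    + (a ℕ.+ b) ℤ.* + (s ℕ.* s) ∎
    where
    open ≡-Reasoning
    distrib : ∀ a b s → (a ℕ.* s ℕ.+ b ℕ.* s) ℕ.* s ≡ (a ℕ.+ b) ℕ.* (s ℕ.* s)
    distrib = solve-∀

0≤frac : ∀ a n → 0ℚ ≤ frac a n
0≤frac a n = frac-≤ {0} {a} {0} {n} z≤n

inv-antimono : ∀ {m n} → m ℕ.≤ n → inv n ≤ inv m
inv-antimono {m} {n} m≤n = frac-≤ {1} {1} {n} {m} (ℕ.+-monoˡ-≤ 0 (s≤s m≤n))

inv2<inv : ∀ k → inv2 (2 ℕ.* suc k) < inv k
inv2<inv k = frac-< {2} {1} {2 ℕ.* suc k} {k} (ℕ.≤-reflexive (sym (ℕ.*-identityˡ _)))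

p≤p+q : ∀ p {q} → 0ℚ ≤ q → p ≤ p + q
p≤p+q p 0≤q = subst (_≤ p + _) (+-identityʳ p) (+-monoʳ-≤ p 0≤q)

p≤∣p∣ : ∀ p → p ≤ ∣ p ∣
p≤∣p∣ p with ∣p∣≡p∨∣p∣≡-p p
... | inj₁ ∣p∣≡p = ≤-reflexive (sym ∣p∣≡p)
... | inj₂ ∣p∣≡-p = ≤-trans p≤0 (0≤∣p∣ p)
  where
  p≤0 : p ≤ 0ℚ
  p≤0 = subst (_≤ 0ℚ) (solve 1 (λ p → :- (:- p) := p) refl p)
          (neg-antimono-≤ (subst (0ℚ ≤_) ∣p∣≡-p (0≤∣p∣ p)))

+-cancelʳ-< : ∀ p q r → p + r < q + r → p < q
+-cancelʳ-< p q r lt = subst₂ _<_ (cancel p) (cancel q) (+-monoˡ-< (- r) lt)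
  where
  cancel : ∀ p → p + r + - r ≡ p
  cancel p = solve 2 (λ p r → p :+ r :+ :- r := p) refl p r

∣p-p∣≡0 : ∀ p → ∣ p - p ∣ ≡ 0ℚ
∣p-p∣≡0 p = cong ∣_∣ (+-inverseʳ p)

∣0-p∣≡p : ∀ {p} → 0ℚ ≤ p → ∣ 0ℚ - p ∣ ≡ p
∣0-p∣≡p {p} 0≤p = trans (cong ∣_∣ (+-identityˡ (- p))) (trans (∣-p∣≡∣p∣ p) (0≤p⇒∣p∣≡p 0≤p))

∣p-q∣≡∣q-p∣ : ∀ p q → ∣ p - q ∣ ≡ ∣ q - p ∣
∣p-q∣≡∣q-p∣ p q = trans (sym (∣-p∣≡∣p∣ (p - q)))
  (cong ∣_∣ (solve 2 (λ p q → :- (p :- q) := q :- p) refl p q))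

∣p-r∣≤∣p-q∣+∣q-r∣ : ∀ p q r → ∣ p - r ∣ ≤ ∣ p - q ∣ + ∣ q - r ∣
∣p-r∣≤∣p-q∣+∣q-r∣ p q r = subst (λ x → ∣ x ∣ ≤ ∣ p - q ∣ + ∣ q - r ∣)
  (solve 3 (λ p q r → (p :- q) :+ (q :- r) := p :- r) refl p q r)
  (∣p+q∣≤∣p∣+∣q∣ (p - q) (q - r))

constℝ : ℚ → ℝ
constℝ q = mkℝ (λ _ → q)
  (λ m n → subst (_≤ inv m + inv n) (sym (∣p-p∣≡0 q)) (+-mono-≤ (0≤frac 1 m) (0≤frac 1 n)))

const-≤ˢ : ∀ {p q} → p ≤ q → (λ _ → p) ≤ˢ (λ _ → q)
const-≤ˢ {p} {q} p≤q (n , q+2/n<p) =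
  <-irrefl refl (≤-<-trans (≤-trans p≤q (p≤p+q q (0≤frac 2 n))) q+2/n<p)

seq≤seq+inv+inv : ∀ (x : ℝ) m n → seq x m ≤ seq x n + (inv m + inv n)
seq≤seq+inv+inv x m n =
  subst (_≤ seq x n + (inv m + inv n)) (solve 2 (λ a b → b :+ (a :- b) := a) refl (seq x m) (seq x n))
    (+-monoʳ-≤ (seq x n) (≤-trans (p≤∣p∣ _) (reg x m n)))

sequenceSpace : (ℕ → ℚ) → MetricSpace
sequenceSpace c = record
  { Carrier = ℕ
  ; d       = λ m n → constℝ ∣ c m - c n ∣
  ; d-refl  = λ x → const-≤ˢ (≤-reflexive (∣p-p∣≡0 (c x))) , const-≤ˢ (0≤∣p∣ (c x - c x))
  ; d-sym   = λ x y → const-≤ˢ (≤-reflexive (∣p-q∣≡∣q-p∣ (c x) (c y)))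
                    , const-≤ˢ (≤-reflexive (∣p-q∣≡∣q-p∣ (c y) (c x)))
  ; d-tri   = λ x y z → const-≤ˢ (∣p-r∣≤∣p-q∣+∣q-r∣ (c x) (c y) (c z))
  }

sequenceSpace-separable : ∀ c → Separable (sequenceSpace c)
sequenceSpace-separable c = (λ n → n) , λ x ε → λ (n , 0+2/n<ε) →
  x , n , subst (λ q → q + inv2 n < seq ε n) (sym (∣p-p∣≡0 (c x))) 0+2/n<ε

next : ℕ × ℕ → ℕ × ℕ
next (zero  , b) = suc b , zero
next (suc a , b) = a , suc b

unpair : ℕ → ℕ × ℕ
unpair zero    = 0 , 0
unpair (suc k) = next (unpair k)

unpair-surjective : ∀ a b → ∃[ k ] (unpair k ≡ (a , b))
unpair-surjective a b = onDiagonal (a ℕ.+ b) a b refl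
  where
  onDiagonal : ∀ s a b → a ℕ.+ b ≡ s → ∃[ k ] (unpair k ≡ (a , b))
  onDiagonal zero    zero    zero    _ = 0 , refl
  onDiagonal s       a       (suc b) e with onDiagonal s (suc a) b (trans (sym (ℕ.+-suc a b)) e)
  ... | k , eq = suc k , cong next eq
  onDiagonal (suc s) (suc a) zero    e with onDiagonal s zero a (trans (sym (ℕ.+-identityʳ a)) (ℕ.suc-injective e))
  ... | k , eq = suc k , cong next eq

ballOpen : (X : MetricSpace) → MetricSpace.Carrier X → ℝ → MetricSpace.Open X
ballOpen X y ρ = mkOpen (Ball y ρ) ((λ _ → just (y , ρ)) , λ z →
  mk⇔ (λ z∈B → 0 , y , ρ , refl , z∈B) λ { (_ , _ , _ , refl , z∈B) → z∈B })
  where open MetricSpace X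

witness : ∀ {A : Set} (a? : Dec A) → does a? ≡ true → A
witness (yes a) _ = a

Eventually : (ℕ → Set) → Set
Eventually P = ∃[ n ] (∀ m → n ℕ.≤ m → P m)

eventually-all : ∀ {P} → (∀ m → P m) → Eventually P
eventually-all P = 0 , λ m _ → P m

eventually-map : ∀ {P Q} → (∀ m → P m → Q m) → Eventually P → Eventually Q
eventually-map f (n , P) = n , λ m n≤m → f m (P m n≤m)

eventually-× : ∀ {P Q} → Eventually P → Eventually Q → Eventually (λ m → P m × Q m)
eventually-× (n₁ , P) (n₂ , Q) = n₁ ℕ.⊔ n₂ , λ m n≤m →
  P m (ℕ.≤-trans (ℕ.m≤m⊔n n₁ n₂) n≤m) , Q m (ℕ.≤-trans (ℕ.m≤n⊔m n₁ n₂) n≤m)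

module FirstHit (α : ℕ → Bool) where

  hitAt : ℕ → Maybe ℕ
  hitAt n = if α n then just n else nothing

  firstHit : ℕ → Maybe ℕ
  firstHit zero    = hitAt zero
  firstHit (suc n) = firstHit n <∣> hitAt (suc n)

  hitAt-sound : ∀ {n k} → hitAt n ≡ just k → k ≡ n × α n ≡ true
  hitAt-sound {n} e with α n
  hitAt-sound refl | true = refl , refl

  hitAt-complete : ∀ {n} → α n ≡ true → hitAt n ≡ just n
  hitAt-complete {n} αn rewrite αn = refl

  firstHit-stable : ∀ {n m k} → firstHit n ≡ just k → n ℕ.≤ m → firstHit m ≡ just k
  firstHit-stable e n≤m = along e (ℕ.≤⇒≤′ n≤m)
    where
    along : ∀ {n m k} → firstHit n ≡ just k → n ≤′ m → firstHit m ≡ just k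
    along e ≤′-refl = e
    along {m = suc m} e (≤′-step n≤m) rewrite along e n≤m = refl

  firstHit-sound : ∀ n {k} → firstHit n ≡ just k → k ℕ.≤ n × firstHit k ≡ just k × α k ≡ true
  firstHit-sound zero e with hitAt-sound e
  ... | refl , αk = z≤n , e , αk
  firstHit-sound (suc n) e with firstHit n in e₀
  firstHit-sound (suc n) refl | just k with firstHit-sound n e₀
  ... | k≤n , hit , αk = ℕ.m≤n⇒m≤1+n k≤n , hit , αk
  firstHit-sound (suc n) e | nothing with hitAt-sound e
  ... | refl , αk = ℕ.≤-refl , trans (cong (_<∣> hitAt (suc n)) e₀) e , αk

  firstHit-complete : ∀ {m} → α m ≡ true → ∃[ k ] (firstHit m ≡ just k)
  firstHit-complete {zero}  αm = 0 , hitAt-complete αm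
  firstHit-complete {suc m} αm with firstHit m
  ... | just k  = k , refl
  ... | nothing = suc m , hitAt-complete αm

  firstHit-nothing-< : ∀ {n m k} → firstHit n ≡ nothing → firstHit m ≡ just k → n ℕ.< k
  firstHit-nothing-< {n} {m} {k} none hit with k ℕ.≤? n
  ... | no k≰n = ℕ.≰⇒> k≰n
  ... | yes k≤n with trans (sym none) (firstHit-stable (proj₁ (proj₂ (firstHit-sound m hit))) k≤n)
  ... | ()

module TailPoint (α : ℕ → Bool) where

  open FirstHit α

  hitValue : Maybe ℕ → ℚ
  hitValue nothing  = 0ℚ
  hitValue (just k) = inv k

  c : ℕ → ℚ
  c n = hitValue (firstHit n)

  X : MetricSpace
  X = sequenceSpace c

  open MetricSpace X

  ∣c-c∣≤inv : ∀ {n m} → n ℕ.≤ m → ∣ c n - c m ∣ ≤ inv n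
  ∣c-c∣≤inv {n} {m} n≤m with firstHit n in en | firstHit m in em
  ... | nothing | nothing = subst (_≤ inv n) (sym (∣p-p∣≡0 0ℚ)) (0≤frac 1 n)
  ... | nothing | just k  = subst (_≤ inv n) (sym (∣0-p∣≡p (0≤frac 1 k)))
                              (inv-antimono (ℕ.<⇒≤ (firstHit-nothing-< {n} {m} en em)))
  ... | just k  | b with trans (sym em) (firstHit-stable en n≤m)
  ...   | refl = subst (_≤ inv n) (sym (∣p-p∣≡0 (inv k))) (0≤frac 1 n)

  dist : ℕ → ℕ → ℚ
  dist m n = ∣ c m - c n ∣

  margin : ℕ → ℚ
  margin n = inv n + inv2 n

  balls : Open → ℕ → Maybe (ℕ × ℝ)
  balls U = proj₁ (isOpen U)

  Captures : Open → Set
  Captures U = ∃[ j ] ∃[ y ] ∃[ ρ ] ∃[ n ]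
    (balls U j ≡ just (y , ρ)) × (dist y n + margin n < seq ρ n)

  captures⇒eventually : ∀ U → Captures U → Eventually (mem U)
  captures⇒eventually U (j , y , ρ , n , e , h) = n , λ m n≤m →
    Equivalence.from (proj₂ (isOpen U) m) (j , y , ρ , e , n , inBall m n≤m)
    where
    inBall : ∀ m → n ℕ.≤ m → dist y m + inv2 n < seq ρ n
    inBall m n≤m = ≤-<-trans
      (≤-trans (+-monoˡ-≤ (inv2 n) (≤-trans (∣p-r∣≤∣p-q∣+∣q-r∣ (c y) (c n) (c m))
                                            (+-monoʳ-≤ (dist y n) (∣c-c∣≤inv n≤m))))
               (≤-reflexive (+-assoc (dist y n) (inv n) (inv2 n))))
      h

  -- T is chosen so that 4/(T+1) ≤ 1/(m+1), which absorbs both the margin at T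
  -- and the regularity defect of ρ between stages m and T.
  captures-beyond : ∀ U {a} → mem U a → ∃[ T ] (a ℕ.≤ T × (c T ≡ c a → Captures U))
  captures-beyond U {a} a∈U with Equivalence.to (proj₂ (isOpen U) a) a∈U
  ... | j , y , ρ , e , m , h = T , ℕ.m≤m+n a _ , λ cT≡ca → j , y , ρ , T , e , within cT≡ca
    where
    T = a ℕ.+ (4 ℕ.* m ℕ.+ 3)
    4/T≤1/m : frac 4 T ≤ inv m
    4/T≤1/m = frac-≤ {4} {1} {T} {m} (subst₂ ℕ._≤_ (four m) (shift a m) (ℕ.m≤n+m (4 ℕ.* m ℕ.+ 4) a))
      where
      four : ∀ m → 4 ℕ.* m ℕ.+ 4 ≡ 4 ℕ.* suc m
      four = solve-∀
      shift : ∀ a m → a ℕ.+ (4 ℕ.* m ℕ.+ 4) ≡ 1 ℕ.* suc (a ℕ.+ (4 ℕ.* m ℕ.+ 3))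
      shift = solve-∀
    slack : margin T + (inv m + inv T) ≡ inv m + frac 4 T
    slack = begin
      (inv T + inv2 T) + (inv m + inv T)
        ≡⟨ solve 3 (λ p q r → (p :+ q) :+ (r :+ p) := r :+ ((p :+ p) :+ q)) refl (inv T) (inv2 T) (inv m) ⟩
      inv m + ((inv T + inv T) + inv2 T) ≡⟨ cong (λ q → inv m + (q + inv2 T)) (frac-+ 1 1 T) ⟩
      inv m + (inv2 T + inv2 T)           ≡⟨ cong (_+_ (inv m)) (frac-+ 2 2 T) ⟩
      inv m + frac 4 T                    ∎
      where open ≡-Reasoning
    within : c T ≡ c a → dist y T + margin T < seq ρ T
    within cT≡ca rewrite cT≡ca = +-cancelʳ-< _ _ (inv m + inv T) (begin-strict
      dist y a + margin T + (inv m + inv T)   ≡⟨ +-assoc (dist y a) (margin T) _ ⟩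
      dist y a + (margin T + (inv m + inv T)) ≡⟨ cong (_+_ (dist y a)) slack ⟩
      dist y a + (inv m + frac 4 T)           ≤⟨ +-monoʳ-≤ (dist y a) (+-monoʳ-≤ (inv m) 4/T≤1/m) ⟩
      dist y a + (inv m + inv m)              ≡⟨ cong (_+_ (dist y a)) (frac-+ 1 1 m) ⟩
      dist y a + inv2 m                       <⟨ h ⟩
      seq ρ m                                 ≤⟨ seq≤seq+inv+inv ρ m T ⟩
      seq ρ T + (inv m + inv T)               ∎)
      where open ≤-Reasoning

  captures-after-hit : ∀ U {a k} → firstHit a ≡ just k → mem U a → Captures U
  captures-after-hit U {a} hit a∈U with captures-beyond U a∈U
  ... | T , a≤T , captured = captured (trans (cong hitValue (firstHit-stable hit a≤T)) (sym (cong hitValue hit)))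

  -- Either the first hit has happened by stage n, or c is still 0 at the stage T
  -- that captures-beyond asks for, or the hit happened in between.
  captures-some-cover : ∀ {ℓ} {I : Set ℓ} (F : I → Open) W → Eventually (mem W) →
                        (∀ z → mem W z → ∃[ i ] mem (F i) z) → ∃[ i ] Captures (F i)
  captures-some-cover F W (n , tail) cover with cover n (tail n ℕ.≤-refl) | firstHit n in en
  ... | i , n∈Fi | just k = i , captures-after-hit (F i) en n∈Fi
  ... | i , n∈Fi | nothing with captures-beyond (F i) n∈Fi
  ... | T , n≤T , captured with firstHit T in eT
  ...   | nothing = i , captured (sym (cong hitValue en))
  ...   | just k with cover T (tail T n≤T)
  ...     | i′ , T∈Fi′ = i′ , captures-after-hit (F i′) eT T∈Fi′

  eventually⇒captures : ∀ W → Eventually (mem W) → Captures W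
  eventually⇒captures W ev = proj₂ (captures-some-cover {I = ⊤} (λ _ → W) W ev (λ _ z∈W → tt , z∈W))

  captureTest : Maybe (ℕ × ℝ) → ℕ → Bool
  captureTest nothing        _ = false
  captureTest (just (y , ρ)) n = does (dist y n + margin n <? seq ρ n)

  captures-Σ : ∀ U → InΣ (Captures U)
  captures-Σ U = test , mk⇔ found sound
    where
    test : ℕ → Bool
    test k = captureTest (balls U (proj₁ (unpair k))) (proj₂ (unpair k))
    found : Captures U → ∃[ k ] (test k ≡ true)
    found (j , y , ρ , n , e , h) with unpair-surjective j n
    ... | k , refl = k , trans (cong (λ b → captureTest b n) e) (dec-true (dist y n + margin n <? seq ρ n) h)
    sound : ∃[ k ] (test k ≡ true) → Captures U
    sound (k , t) with unpair k
    ... | j , n with balls U j in e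
    ...   | nothing      = case t of λ ()
    ...   | just (y , ρ) = j , y , ρ , n , e , witness (dist y n + margin n <? seq ρ n) t

  eventually-join : ∀ (F : ℕ → Maybe Open) W →
                    (∀ z → mem W z ⇔ (∃[ n ] ∃[ U ] ((F n ≡ just U) × mem U z))) →
                    Eventually (mem W) → ∃[ n ] ∃[ U ] ((F n ≡ just U) × Eventually (mem U))
  eventually-join F W W≐⋃F ev =
    let ((n , U , e) , captured) = captures-some-cover member W ev cover
    in n , U , e , captures⇒eventually U captured
    where
    member : (∃[ n ] ∃[ U ] (F n ≡ just U)) → Open
    member (_ , U , _) = U
    cover : ∀ z → mem W z → ∃[ i ] mem (member i) z
    cover z z∈W with Equivalence.to (W≐⋃F z) z∈W
    ... | n , U , e , z∈U = (n , U , e) , z∈U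

  tailPoint : Point
  tailPoint = record
    { φ      = λ U → Eventually (mem U)
    ; φ-Σ    = λ U → let (test , captures⇔test) = captures-Σ U in
                 test , captures⇔test ⇔-∘ mk⇔ (eventually⇒captures U) (captures⇒eventually U)
    ; φ-ext  = λ U V U≐V → mk⇔ (eventually-map (λ z → Equivalence.to (U≐V z)))
                                (eventually-map (λ z → Equivalence.from (U≐V z)))
    ; φ-top  = λ W W≐M → mk⇔ (λ _ → tt) (λ _ → eventually-all W≐M)
    ; φ-meet = λ U V W W≐U∩V → mk⇔
        (λ ev → eventually-map (λ z → proj₁ ∘ Equivalence.to (W≐U∩V z)) ev
              , eventually-map (λ z → proj₂ ∘ Equivalence.to (W≐U∩V z)) ev)
        (λ (evU , evV) → eventually-map (λ z → Equivalence.from (W≐U∩V z)) (eventually-× evU evV))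
    ; φ-join = λ F W W≐⋃F → mk⇔ (eventually-join F W W≐⋃F)
        (λ (n , U , e , evU) → eventually-map (λ z z∈U → Equivalence.from (W≐⋃F z) (n , U , e , z∈U)) evU)
    }

  tailLimit-decides : ∀ x → (∀ U → Eventually (mem U) ⇔ mem U x) →
                      (∀ n → α n ≡ false) ⊎ (∃[ n ] (α n ≡ true))
  tailLimit-decides x x̂≐tail with firstHit x in ex
  ... | just k  = inj₂ (k , proj₂ (proj₂ (firstHit-sound x ex)))
  ... | nothing = inj₁ λ m → ¬-not (noHit m)
    where
    centre∈ball : ∀ k → Ball x (constℝ (inv k)) x
    centre∈ball k = 2 ℕ.* suc k , subst (λ q → q + inv2 (2 ℕ.* suc k) < inv k) (sym (∣p-p∣≡0 (c x)))
                                   (subst (_< inv k) (sym (+-identityˡ _)) (inv2<inv k))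
    dist-after-hit : ∀ {m k} → firstHit m ≡ just k → ∀ n → m ℕ.≤ n → dist x n ≡ inv k
    dist-after-hit {k = k} hm n m≤n =
      trans (cong₂ (λ p q → ∣ p - q ∣) (cong hitValue ex) (cong hitValue (firstHit-stable hm m≤n)))
            (∣0-p∣≡p (0≤frac 1 k))
    noHit : ∀ m → ¬ (α m ≡ true)
    noHit m αm with firstHit-complete αm
    ... | k , hm with Equivalence.from (x̂≐tail (ballOpen X x (constℝ (inv k)))) (centre∈ball k)
    ... | n₀ , tail∈B = const-≤ˢ (≤-reflexive (sym (dist-after-hit hm (n₀ ℕ.⊔ m) (ℕ.m≤n⊔m n₀ m))))
                                 (tail∈B (n₀ ℕ.⊔ m) (ℕ.m≤m⊔n n₀ m))

proposition3p8 : (∀ (X : MetricSpace) → Separable X → Sober X) → LPO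
proposition3p8 sober α =
  let (x , x̂≐tail) = proj₂ (sober X (sequenceSpace-separable c)) tailPoint
  in tailLimit-decides x x̂≐tail
  where open TailPoint α
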